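{- Let $\Delta,\Gamma$ be arbitrary contexts (both possibly containing locks) and $A$ an arbitrary type. There is an operation $(\Gamma\vdash A)\to(\Delta\mathbin{+\!\!+}\Gamma\vdash A)$ on terms of IKC, and likewise on terms of IS4C, where $\Delta\mathbin{+\!\!+}\Gamma$ denotes context concatenation.
   Context: Types $A,B::=\iota\mid A\Rightarrow B\mid\Box A$; contexts $\Gamma::=\cdot\mid\Gamma,A\mid\Gamma,\blacksquare$ (snoc lists; $\blacksquare$ a lock); $\Delta\mathbin{+\!\!+}\cdot=\Delta$, $\Delta\mathbin{+\!\!+}(\Gamma,A)=(\Delta\mathbin{+\!\!+}\Gamma),A$, $\Delta\mathbin{+\!\!+}(\Gamma,\blacksquare)=(\Delta\mathbin{+\!\!+}\Gamma),\blacksquare$. Terms of both calculi: de Bruijn variables ($\mathsf{zero}:(\Gamma,A)\vdash_{var}A$, $\mathsf{succ}\,v:(\Gamma,B)\vdash_{var}A$ for $v:\Gamma\vdash_{var}A$; no variable passes a lock), $\lambda$-abstraction, application, $\Gamma\vdash\mathsf{box}\,t:\Box A$ for $(\Gamma,\blacksquare)\vdash t:A$, and $\Gamma\vdash\mathsf{unbox}(t,e):A$ for $\Delta\vdash t:\Box A$ and $e:\Delta\lhd\Gamma$. In IKC, $\Delta\lhd\Gamma$ is generated by $\mathsf{nil}:\Gamma\lhd(\Gamma,\blacksquare)$ and $\mathsf{ext}\,e:\Delta\lhd(\Gamma,A)$ for $e:\Delta\lhd\Gamma$. In IS4C, it is generated by $\mathsf{nil}:\Gamma\lhd\Gamma$,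 $\mathsf{ext}\,e:\Delta\lhd(\Gamma,A)$ and $\mathsf{lock}\,e:\Delta\lhd(\Gamma,\blacksquare)$ for $e:\Delta\lhd\Gamma$. -}

module Defs where

open import Data.Product using (_×_)

data Ty : Set where
  ι   : Ty
  _⇒_ : Ty → Ty → Ty
  □_  : Ty → Ty

infixr 7 _⇒_

data Ctx : Set where
  ·    : Ctx
  _,_  : Ctx → Ty → Ctx
  _,🔒 : Ctx → Ctx

infixl 5 _,_
infixl 5 _,🔒

_++_ : Ctx → Ctx → Ctx
Δ ++ ·        = Δ
Δ ++ (Γ , A)  = (Δ ++ Γ) , A
Δ ++ (Γ ,🔒)  = (Δ ++ Γ) ,🔒

infixl 4 _++_

-- de Bruijn variables (no variable passes a lock)
data Var : Ctx → Ty → Set where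
  zero : ∀ {Γ A} → Var (Γ , A) A
  succ : ∀ {Γ A B} → Var Γ A → Var (Γ , B) A

module IKC where
  data _◁_ : Ctx → Ctx → Set where
    nil : ∀ {Γ} → Γ ◁ (Γ ,🔒)
    ext : ∀ {Δ Γ A} → Δ ◁ Γ → Δ ◁ (Γ , A)

  data Tm : Ctx → Ty → Set where
    var   : ∀ {Γ A} → Var Γ A → Tm Γ A
    lam   : ∀ {Γ A B} → Tm (Γ , A) B → Tm Γ (A ⇒ B)
    app   : ∀ {Γ A B} → Tm Γ (A ⇒ B) → Tm Γ A → Tm Γ B
    box   : ∀ {Γ A} → Tm (Γ ,🔒) A → Tm Γ (□ A)
    unbox : ∀ {Γ Δ A} → Tm Δ (□ A) → Δ ◁ Γ → Tm Γ A

module IS4C where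
  data _◁_ : Ctx → Ctx → Set where
    nil  : ∀ {Γ} → Γ ◁ Γ
    ext  : ∀ {Δ Γ A} → Δ ◁ Γ → Δ ◁ (Γ , A)
    lock : ∀ {Δ Γ} → Δ ◁ Γ → Δ ◁ (Γ ,🔒)

  data Tm : Ctx → Ty → Set where
    var   : ∀ {Γ A} → Var Γ A → Tm Γ A
    lam   : ∀ {Γ A B} → Tm (Γ , A) B → Tm Γ (A ⇒ B)
    app   : ∀ {Γ A B} → Tm Γ (A ⇒ B) → Tm Γ A → Tm Γ B
    box   : ∀ {Γ A} → Tm (Γ ,🔒) A → Tm Γ (□ A)
    unbox : ∀ {Γ Δ A} → Tm Δ (□ A) → Δ ◁ Γ → Tm Γ A

module Submission where

open import Defs
open import Data.Product using (_×_; Σ-syntax) renaming (_,_ to _&_)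

-- Terms are weakened along order-preserving embeddings that keep every lock.
-- The only interesting case is unbox t e with e : Δ ◁ Γ: the embedding of Γ
-- is transported back through e to an embedding of the prefix Δ into some
-- Δ' with Δ' ◁ Γ', along which t is weakened.  Γ embeds into Δ ++ Γ.

data _⊆_ : Ctx → Ctx → Set where
  base  : ∀ {Γ} → · ⊆ Γ
  drop  : ∀ {Γ Γ' A} → Γ ⊆ Γ' → Γ ⊆ (Γ' , A)
  keep  : ∀ {Γ Γ' A} → Γ ⊆ Γ' → (Γ , A) ⊆ (Γ' , A)
  keep🔒 : ∀ {Γ Γ'} → Γ ⊆ Γ' → (Γ ,🔒) ⊆ (Γ' ,🔒)

Γ⊆Δ++Γ : ∀ Δ Γ → Γ ⊆ (Δ ++ Γ)
Γ⊆Δ++Γ Δ ·       = base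
Γ⊆Δ++Γ Δ (Γ , A) = keep (Γ⊆Δ++Γ Δ Γ)
Γ⊆Δ++Γ Δ (Γ ,🔒)  = keep🔒 (Γ⊆Δ++Γ Δ Γ)

wkVar : ∀ {Γ Γ' A} → Γ ⊆ Γ' → Var Γ A → Var Γ' A
wkVar (drop w) v        = succ (wkVar w v)
wkVar (keep w) zero     = zero
wkVar (keep w) (succ v) = succ (wkVar w v)

module IKC-Weakening where
  open IKC

  wk◁ : ∀ {Δ Γ Γ'} → Γ ⊆ Γ' → Δ ◁ Γ → Σ[ Δ' ∈ Ctx ] Δ ⊆ Δ' × Δ' ◁ Γ'
  wk◁ (drop w) e with wk◁ w e
  ... | Δ' & w' & e' = Δ' & w' & ext e'
  wk◁ (keep w) (ext e) with wk◁ w e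
  ... | Δ' & w' & e' = Δ' & w' & ext e'
  wk◁ (keep🔒 w) nil = _ & w & nil

  wkTm : ∀ {Γ Γ' A} → Γ ⊆ Γ' → Tm Γ A → Tm Γ' A
  wkTm w (var v)     = var (wkVar w v)
  wkTm w (lam t)     = lam (wkTm (keep w) t)
  wkTm w (app t u)   = app (wkTm w t) (wkTm w u)
  wkTm w (box t)     = box (wkTm (keep🔒 w) t)
  wkTm w (unbox t e) with wk◁ w e
  ... | Δ' & w' & e' = unbox (wkTm w' t) e'

module IS4C-Weakening where
  open IS4C

  wk◁ : ∀ {Δ Γ Γ'} → Γ ⊆ Γ' → Δ ◁ Γ → Σ[ Δ' ∈ Ctx ] Δ ⊆ Δ' × Δ' ◁ Γ'
  wk◁ w nil = _ & w & nil
  wk◁ (drop w) e with wk◁ w e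
  ... | Δ' & w' & e' = Δ' & w' & ext e'
  wk◁ (keep w) (ext e) with wk◁ w e
  ... | Δ' & w' & e' = Δ' & w' & ext e'
  wk◁ (keep🔒 w) (lock e) with wk◁ w e
  ... | Δ' & w' & e' = Δ' & w' & lock e'

  wkTm : ∀ {Γ Γ' A} → Γ ⊆ Γ' → Tm Γ A → Tm Γ' A
  wkTm w (var v)     = var (wkVar w v)
  wkTm w (lam t)     = lam (wkTm (keep w) t)
  wkTm w (app t u)   = app (wkTm w t) (wkTm w u)
  wkTm w (box t)     = box (wkTm (keep🔒 w) t)
  wkTm w (unbox t e) with wk◁ w e
  ... | Δ' & w' & e' = unbox (wkTm w' t) e'

lemma4p7 : ((Δ Γ : Ctx) (A : Ty) → IKC.Tm Γ A → IKC.Tm (Δ ++ Γ) A)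
         × ((Δ Γ : Ctx) (A : Ty) → IS4C.Tm Γ A → IS4C.Tm (Δ ++ Γ) A)
lemma4p7 = (λ Δ Γ A → IKC-Weakening.wkTm (Γ⊆Δ++Γ Δ Γ))
         & (λ Δ Γ A → IS4C-Weakening.wkTm (Γ⊆Δ++Γ Δ Γ))
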